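{- Let $G$ be a graph with property $(*)$. The affine map $\psi:\mathbb{R}^{\mathrm{faces}(G)}\to\mathbb{R}^{E(G)}$, $\psi(\mathbf x)=A_G\mathbf x+\chi_{\hat0}$, is an affine isomorphism between the Newton polytope $\mathrm{Newton}(D_G)$ and the perfect matching polytope $PM(G)$, i.e. $\psi$ restricted to $\mathrm{Newton}(D_G)$ is a bijection onto $PM(G)$.
   Context: Property $(*)$: $G$ is a finite connected bipartite plane graph with fixed proper black/white coloring, every edge lying in some perfect matching; $E(G)$ is its edge set and $\mathrm{faces}(G)$ its set of bounded faces. An edge of a bounded face $f$ is black-white if going clockwise around $f$ one meets its black endpoint first, white-black otherwise. Down-flip at $f$: if a perfect matching contains all black-white edges of $f$, replace them with the white-black edges (inverse: up-flip). Perfect matchings with $M\le M'$ iff $M$ is obtained from $M'$ by down-flips form a distributive lattice with minimum $\hat0$. For a saturated chain $\hat0=M_0\lessdot\cdots\lessdot M_\ell=M$ with $M_{i-1},M_i$ related by a flip at $f_i$, $\mathrm{mrk}(M)=y_{f_1}\cdots y_{f_\ell}$ (chain-independent); $D_G=\sum_M\mathrm{mrk}(M)$. The Newton polytope of a polynomial is the convex hull of the exponent vectors of its monomials with nonzero coefficient. $PM(G)$ is the convex hull of the indicator vectors $\chi_M\in\{0,1\}^{E(G)}$ of perfect matchings $M$. For $f\in\mathrm{faces}(G)$, $\mathbf v_f\in\mathbb{R}^{E(G)}$ has entry $1$ at black-white edges of $f$, $-1$ at white-black edges of $f$, and $0$ at edges not on $f$; $A_G$ is the matrix with columns $\mathbf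 v_f$, $f\in\mathrm{faces}(G)$.
   Formalization: The points of $\mathrm{Newton}(D_G)$ and $PM(G)$, the weights of their convex combinations, and the map ψ are taken over ℚ rather than ℝ. -}

module Defs where

open import Data.Nat using (ℕ; zero; suc; _+_)
open import Data.Bool using (Bool; true; false; not; if_then_else_; _∧_; _∨_)
open import Data.Fin using (Fin; zero; suc; _≟_)
open import Data.Fin.Subset using (Subset)
open import Data.Vec using (lookup)
open import Data.List using (List; []; _∷_; map)
open import Data.List.Relation.Unary.All using (All)
open import Data.Product using (Σ; ∃; ∃-syntax; _×_; _,_; proj₁; proj₂)
open import Data.Sum using (_⊎_)
open import Data.Integer using (+_)
open import Data.Rational using (ℚ; 0ℚ; 1ℚ; _≤_; -_)
import Data.Rational as ℚ
open import Relation.Nullary using (¬_)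
open import Relation.Nullary.Decidable using (⌊_⌋)
open import Relation.Binary.PropositionalEquality using (_≡_; _≢_)
open import Relation.Binary.Construct.Closure.ReflexiveTransitive using (Star)

iter : ∀ {A : Set} → (A → A) → ℕ → A → A
iter f zero    a = a
iter f (suc k) a = f (iter f k a)

sumFin : ∀ {n} → (Fin n → ℚ) → ℚ
sumFin {zero}  f = 0ℚ
sumFin {suc n} f = f zero ℚ.+ sumFin (λ i → f (suc i))

sumList : List ℚ → ℚ
sumList []       = 0ℚ
sumList (q ∷ qs) = q ℚ.+ sumList qs

ℕ→ℚ : ℕ → ℚ
ℕ→ℚ n = (+ n) ℚ./ 1

ConvHull : ∀ {n} → ((Fin n → ℚ) → Set) → (Fin n → ℚ) → Set
ConvHull {n} S x =
  Σ (List (ℚ × (Fin n → ℚ))) λ ws →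
      All (λ w → (0ℚ ≤ proj₁ w) × S (proj₂ w)) ws
    × sumList (map proj₁ ws) ≡ 1ℚ
    × (∀ i → x i ≡ sumList (map (λ w → proj₁ w ℚ.* proj₂ w i) ws))

-- Finite connected bipartite plane graphs, encoded as combinatorial
-- maps (rotation systems) of genus 0.
--
-- Edges are Fin nE; a dart is (e , s), s : Bool, going from  end e s
-- to  end e (not s).  σ is the counterclockwise rotation of darts around
-- their tail vertex.  With this convention the permutation
-- φ = σ ∘ α (α reverses a dart) traverses every bounded face clockwise
-- (the face lies to the right of each dart of its φ-orbit).
-- Faces are the φ-orbits, labelled by Fin (suc nB); label zero is the
-- outer (unbounded) face, labels suc b (b : Fin nB) are the bounded faces.
-- Planarity: V - E + F = 2 (Euler), for a connected graph.

Dart : ℕ → Set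
Dart nE = Fin nE × Bool

rev : ∀ {nE} → Dart nE → Dart nE
rev (e , s) = (e , not s)

record PlaneBipartiteGraph : Set where
  field
    nV nE nB : ℕ
    end    : Fin nE → Bool → Fin nV
    black  : Fin nV → Bool
    proper : ∀ e → black (end e true) ≢ black (end e false)
    σ      : Dart nE → Dart nE
    σ⁻¹    : Dart nE → Dart nE
    σσ⁻¹   : ∀ d → σ (σ⁻¹ d) ≡ d
    σ⁻¹σ   : ∀ d → σ⁻¹ (σ d) ≡ d
    σ-tail : ∀ d → end (proj₁ (σ d)) (proj₂ (σ d)) ≡ end (proj₁ d) (proj₂ d)
    σ-cyc  : ∀ d d' → end (proj₁ d) (proj₂ d) ≡ end (proj₁ d') (proj₂ d')
                    → ∃[ k ] iter σ k d ≡ d'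
    face      : Dart nE → Fin (suc nB)
    face-φ    : ∀ d → face (σ (rev d)) ≡ face d
    face-orb  : ∀ d d' → face d ≡ face d' → ∃[ k ] iter (λ x → σ (rev x)) k d ≡ d'
    face-surj : ∀ f → ∃[ d ] face d ≡ f
    connected : ∀ u v → Star (λ x y → ∃[ e ] ((end e true ≡ x × end e false ≡ y)
                                            ⊎ (end e false ≡ x × end e true ≡ y))) u v
    euler : nV + suc nB ≡ nE + 2

module _ (G : PlaneBipartiteGraph) where
  open PlaneBipartiteGraph G

  Edge Vertex BFace : Set
  Edge   = Fin nE
  Vertex = Fin nV
  BFace  = Fin nB

  Matching : Set
  Matching = Subset nE

  χ : Matching → Edge → ℚ
  χ M e = if lookup M e then 1ℚ else 0ℚ

  Incident : Edge → Vertex → Set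
  Incident e v = (end e true ≡ v) ⊎ (end e false ≡ v)

  IsPerfectMatching : Matching → Set
  IsPerfectMatching M = ∀ v →
      (∃[ e ] (lookup M e ≡ true × Incident e v))
    × (∀ e e' → lookup M e ≡ true → lookup M e' ≡ true
              → Incident e v → Incident e' v → e ≡ e')

  onFace : BFace → Edge → Bool → Bool
  onFace b e s = ⌊ face (e , s) ≟ suc b ⌋

  -- e is black-white on b: traversing b clockwise (along its darts) one
  -- meets the black endpoint (the tail of the dart) first.
  isBW : BFace → Edge → Bool
  isBW b e = (onFace b e true ∧ black (end e true))
           ∨ (onFace b e false ∧ black (end e false))

  isWB : BFace → Edge → Bool
  isWB b e = (onFace b e true ∧ not (black (end e true)))
           ∨ (onFace b e false ∧ not (black (end e false)))

  DownFlip : BFace → Matching → Matching → Set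
  DownFlip b M M' =
      (∀ e → isBW b e ≡ true → lookup M e ≡ true)
    × (∀ e → lookup M' e ≡ (if isBW b e then false
                             else if isWB b e then true else lookup M e))

  _≼_ : Matching → Matching → Set
  M ≼ M' = Star (λ X Y → ∃[ b ] DownFlip b X Y) M' M

  IsBottom : Matching → Set
  IsBottom M₀ = IsPerfectMatching M₀ × (∀ M → IsPerfectMatching M → M₀ ≼ M)

  data UpChain : Matching → Matching → List BFace → Set where
    done : ∀ {M} → UpChain M M []
    step : ∀ {M₀ M₁ M b fs} → DownFlip b M₁ M₀ → UpChain M₁ M fs
         → UpChain M₀ M (b ∷ fs)

  -- exponent of y_c in y_{f₁} ⋯ y_{f_ℓ}
  countFace : List BFace → BFace → ℕ
  countFace []       c = 0
  countFace (b ∷ fs) c = (if ⌊ b ≟ c ⌋ then 1 else 0) + countFace fs c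

  -- exponent vectors of the monomials of D_G = Σ_M mrk(M)
  -- (all coefficients are positive integers, so these are exactly the
  -- exponent vectors of monomials with nonzero coefficient)
  DExponent : Matching → (BFace → ℚ) → Set
  DExponent M₀ x = ∃[ M ] ∃[ fs ] (IsPerfectMatching M × UpChain M₀ M fs
                                   × (∀ c → x c ≡ ℕ→ℚ (countFace fs c)))

  Newton-D : Matching → (BFace → ℚ) → Set
  Newton-D M₀ = ConvHull (DExponent M₀)

  PMPolytope : (Edge → ℚ) → Set
  PMPolytope = ConvHull (λ p → ∃[ M ] (IsPerfectMatching M × (∀ e → p e ≡ χ M e)))

  vFace : BFace → Edge → ℚ
  vFace b e = sgn true ℚ.+ sgn false
    where
    sgn : Bool → ℚ
    sgn s = if onFace b e s then (if black (end e s) then 1ℚ else - 1ℚ) else 0ℚ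

  ψ : Matching → (BFace → ℚ) → Edge → ℚ
  ψ M₀ x e = sumFin (λ b → vFace b e ℚ.* x b) ℚ.+ χ M₀ e

  EveryEdgeInPM : Set
  EveryEdgeInPM = ∀ e → ∃[ M ] (IsPerfectMatching M × lookup M e ≡ true)

{-# OPTIONS --safe #-}

-- The exponent vector of mrk(M) counts how often each face is flipped along a chain of up-flips
-- from 0̂ to M, and A_G maps it to the sum over the flips of χ_BW(f) − χ_WB(f), which telescopes
-- to χ_M − χ_0̂.  So ψ sends exponent vectors to the vertices χ_M of PM(G), every perfect matching
-- lies above 0̂, and ψ, being affine, maps Newton(D_G) onto PM(G).  The telescoping is proved by
-- counting, because the intermediate matchings of a chain are not required to be perfect: every
-- face has as many black-white as white-black edges and all perfect matchings have the same size,
-- which forces the slack of the per-flip bookkeeping to vanish.  ψ is injective because A_G has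
-- trivial kernel: if A_G z = 0 then z, extended by 0 to the outer face, agrees on the two faces at
-- each edge, hence is constant around each vertex and, G being connected, vanishes.

module Submission where

open import Defs
open import Data.Product using (_×_; ∃-syntax)
open import Relation.Binary.PropositionalEquality using (_≡_)

open import Algebra.Bundles using (CommutativeMonoid)
open import Data.Bool using (Bool; true; false; not; _∧_; _∨_; if_then_else_)
open import Data.Bool.Properties using (not-involutive; ¬-not; ∧-zeroʳ; ∧-identityʳ)
open import Data.Fin using (Fin; zero; suc; _≟_; _↑ˡ_; _↑ʳ_; splitAt)
open import Data.Fin.Properties
  using (punchInᵢ≢i; suc-injective; splitAt-↑ˡ; splitAt-↑ʳ; splitAt⁻¹-↑ˡ; splitAt⁻¹-↑ʳ)
open import Data.Fin.Permutation using (permutation; _⟨$⟩ʳ_)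
import Data.Integer as ℤ
import Data.Integer.Properties as ℤP
open import Data.List using (List; []; _∷_; map)
open import Data.List.Properties using (map-∘)
open import Data.List.Relation.Unary.All as All using (All; []; _∷_)
open import Data.List.Relation.Unary.All.Properties using (map⁺)
open import Data.Nat as ℕ using (ℕ; zero; suc; z≤n)
import Data.Nat.Properties as ℕP
open import Data.Nat.Tactic.RingSolver using () renaming (solve-∀ to ℕ-solve-∀)
open import Data.Nat.Coprimality using (1-coprimeTo) renaming (sym to coprime-sym)
open import Data.Product using (Σ-syntax; _,_; proj₁; proj₂; map₂)
open import Data.Rational as ℚ using (ℚ; mkℚ; 0ℚ; 1ℚ)
import Data.Rational.Properties as ℚP
open import Data.Sum using (_⊎_; inj₁; inj₂; [_,_]′)
open import Data.Vec using (lookup)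
open import Data.Vec.Functional as Vector using (removeAt)
open import Function using (_∘_; id)
open import Level using (0ℓ)
open import Relation.Binary.Construct.Closure.ReflexiveTransitive using (fold; foldl)
open import Relation.Binary.PropositionalEquality
  using (_≢_; _≗_; refl; sym; trans; cong; cong₂; subst; module ≡-Reasoning)
open import Relation.Nullary using (yes; no)
open import Relation.Nullary.Decidable using (⌊_⌋; isYes≗does; dec-true; dec-false; ⌊⌋-map′; dec⇒maybe)
open import Relation.Nullary.Negation using (contradiction)
open import Tactic.RingSolver using (solve-∀)
open import Tactic.RingSolver.Core.AlmostCommutativeRing using (AlmostCommutativeRing; fromCommutativeRing)

module CommutativeMonoidSum {c ℓ} (M : CommutativeMonoid c ℓ) where
  open CommutativeMonoid M
    using (Carrier; _≈_; setoid; identityˡ; identityʳ; assoc)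
    renaming (ε to 0#; _∙_ to _+_; ∙-congˡ to +-congˡ; trans to ≈-trans; sym to ≈-sym)
  open import Algebra.Properties.CommutativeMonoid.Sum M public
  open import Relation.Binary.Reasoning.Setoid setoid

  sum-zero : ∀ {n} (f : Fin n → Carrier) → (∀ i → f i ≈ 0#) → sum f ≈ 0#
  sum-zero {n} f f≈0 = ≈-trans (sum-cong-≋ f≈0) (sum-replicate-zero n)

  sum-single : ∀ {n} (f : Fin n → Carrier) i → (∀ j → j ≢ i → f j ≈ 0#) → sum f ≈ f i
  sum-single {suc n} f i vanishes = begin
    sum f                    ≈⟨ sum-remove {i = i} f ⟩
    f i + sum (removeAt f i) ≈⟨ +-congˡ (sum-zero _ (λ j → vanishes _ (punchInᵢ≢i i j))) ⟩
    f i + 0#                 ≈⟨ identityʳ (f i) ⟩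
    f i                      ∎

  sum-↑ˡ-↑ʳ : ∀ m {n} (f : Fin (m ℕ.+ n) → Carrier) →
              sum f ≈ sum (λ i → f (i ↑ˡ n)) + sum (λ i → f (m ↑ʳ i))
  sum-↑ˡ-↑ʳ zero    f = ≈-sym (identityˡ (sum f))
  sum-↑ˡ-↑ʳ (suc m) f = ≈-trans (+-congˡ (sum-↑ˡ-↑ʳ m (f ∘ suc))) (≈-sym (assoc _ _ _))

open CommutativeMonoidSum ℕP.+-0-commutativeMonoid
module ℚΣ = CommutativeMonoidSum ℚP.+-0-commutativeMonoid

⌊≟⌋-refl : ∀ {n} (i : Fin n) → ⌊ i ≟ i ⌋ ≡ true
⌊≟⌋-refl i = trans (isYes≗does (i ≟ i)) (dec-true (i ≟ i) refl)

⌊≟⌋-≢ : ∀ {n} {i j : Fin n} → i ≢ j → ⌊ i ≟ j ⌋ ≡ false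
⌊≟⌋-≢ {i = i} {j} i≢j = trans (isYes≗does (i ≟ j)) (dec-false (i ≟ j) i≢j)

𝟙 : Bool → ℕ
𝟙 b = if b then 1 else 0

module _ where
  open import Data.Nat using (_+_; _≤_)

  𝟙-∨-opposite : ∀ o o' t {t'} → t' ≡ not t → 𝟙 ((o ∧ t) ∨ (o' ∧ t')) ≡ 𝟙 (o ∧ t) + 𝟙 (o' ∧ t')
  𝟙-∨-opposite false _     _     refl = refl
  𝟙-∨-opposite true  false true  refl = refl
  𝟙-∨-opposite true  false false refl = refl
  𝟙-∨-opposite true  true  true  refl = refl
  𝟙-∨-opposite true  true  false refl = refl

  m≤o⇒n≤p⇒m+n≡o+p⇒m≡o×n≡p : ∀ {m n o p} → m ≤ o → n ≤ p → m + n ≡ o + p → m ≡ o × n ≡ p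
  m≤o⇒n≤p⇒m+n≡o+p⇒m≡o×n≡p {m} {n} {o} {p} m≤o n≤p eq =
    m≡o , ℕP.+-cancelˡ-≡ m n p (trans eq (cong (_+ p) (sym m≡o)))
    where
    open ℕP.≤-Reasoning
    m≡o : m ≡ o
    m≡o = ℕP.≤-antisym m≤o (ℕP.+-cancelʳ-≤ n o m (begin
      o + n ≤⟨ ℕP.+-monoʳ-≤ o n≤p ⟩
      o + p ≡⟨ sym eq ⟩
      m + n ∎))

  sum-mono-≤ : ∀ {n} {f g : Fin n → ℕ} → (∀ i → f i ≤ g i) → sum f ≤ sum g
  sum-mono-≤ {zero}  _   = z≤n
  sum-mono-≤ {suc n} f≤g = ℕP.+-mono-≤ (f≤g zero) (sum-mono-≤ (f≤g ∘ suc))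

  ≤∧sum≡⇒≗ : ∀ {n} {f g : Fin n → ℕ} → (∀ i → f i ≤ g i) → sum f ≡ sum g → f ≗ g
  ≤∧sum≡⇒≗ {suc n} f≤g eq i with m≤o⇒n≤p⇒m+n≡o+p⇒m≡o×n≡p (f≤g zero) (sum-mono-≤ (f≤g ∘ suc)) eq
  ≤∧sum≡⇒≗ {suc n} f≤g eq zero    | head≡ , _     = head≡
  ≤∧sum≡⇒≗ {suc n} f≤g eq (suc i) | _     , tail≡ = ≤∧sum≡⇒≗ (f≤g ∘ suc) tail≡ i

ℚ-ring : AlmostCommutativeRing 0ℓ 0ℓ
ℚ-ring = fromCommutativeRing ℚP.+-*-commutativeRing (λ q → dec⇒maybe (0ℚ ℚ.≟ q))

module _ where
  open import Data.Rational using (_+_; _*_; _-_; -_)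
  open import Algebra.Properties.Group ℚP.+-0-group using (x∙y⁻¹≈ε⇒x≈y)

  ℕ→ℚ-homo-+ : ∀ m n → ℕ→ℚ (m ℕ.+ n) ≡ ℕ→ℚ m + ℕ→ℚ n
  ℕ→ℚ-homo-+ m n = begin
    ℕ→ℚ (m ℕ.+ n)  ≡⟨ cong (ℚ._/ 1) (cong₂ ℤ._+_ (ℤP.*-identityʳ (ℤ.+ m)) (ℤP.*-identityʳ (ℤ.+ n))) ⟨
    ⟦ m ⟧ + ⟦ n ⟧  ≡⟨ cong₂ _+_ (ℕ→ℚ≡⟦⟧ m) (ℕ→ℚ≡⟦⟧ n) ⟨
    ℕ→ℚ m + ℕ→ℚ n  ∎
    where
    open ≡-Reasoning
    ⟦_⟧ : ℕ → ℚ
    ⟦ k ⟧ = mkℚ (ℤ.+ k) 0 (coprime-sym (1-coprimeTo k))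
    ℕ→ℚ≡⟦⟧ : ∀ k → ℕ→ℚ k ≡ ⟦ k ⟧
    ℕ→ℚ≡⟦⟧ k = ℚP.normalize-coprime (coprime-sym (1-coprimeTo k))

  sign : Bool → ℚ
  sign t = if t then 1ℚ else - 1ℚ

  sign-∨-opposite : ∀ o o' t {t'} → t' ≡ not t →
                 (if o then sign t else 0ℚ) + (if o' then sign t' else 0ℚ)
                   ≡ ℕ→ℚ (𝟙 ((o ∧ t) ∨ (o' ∧ t'))) - ℕ→ℚ (𝟙 ((o ∧ not t) ∨ (o' ∧ not t')))
  sign-∨-opposite false false _     refl = refl
  sign-∨-opposite false true  true  refl = refl
  sign-∨-opposite false true  false refl = refl
  sign-∨-opposite true  false true  refl = refl
  sign-∨-opposite true  false false refl = refl
  sign-∨-opposite true  true  true  refl = refl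
  sign-∨-opposite true  true  false refl = refl

  sign-opposite-cancel : ∀ t {t'} {p q} → t' ≡ not t → sign t * p + sign t' * q ≡ 0ℚ → p ≡ q
  sign-opposite-cancel true  {p = p} {q} refl sum≡0 = x∙y⁻¹≈ε⇒x≈y p q (trans (signs p q) sum≡0)
    where
    signs : ∀ p q → p - q ≡ 1ℚ * p + - 1ℚ * q
    signs = solve-∀ ℚ-ring
  sign-opposite-cancel false {p = p} {q} refl sum≡0 =
    sym (x∙y⁻¹≈ε⇒x≈y q p (trans (signs p q) sum≡0))
    where
    signs : ∀ p q → q - p ≡ - 1ℚ * p + 1ℚ * q
    signs = solve-∀ ℚ-ring

  *-ℕ→ℚ𝟙 : ∀ x β → x * ℕ→ℚ (𝟙 β) ≡ (if β then x else 0ℚ)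
  *-ℕ→ℚ𝟙 x true  = ℚP.*-identityʳ x
  *-ℕ→ℚ𝟙 x false = ℚP.*-zeroʳ x

  sumFin-cong : ∀ {n} {f g : Fin n → ℚ} → f ≗ g → sumFin f ≡ sumFin g
  sumFin-cong {zero}  _   = refl
  sumFin-cong {suc n} f≗g = cong₂ _+_ (f≗g zero) (sumFin-cong (f≗g ∘ suc))

  sumFin-+ : ∀ {n} (f g : Fin n → ℚ) → sumFin (λ i → f i + g i) ≡ sumFin f + sumFin g
  sumFin-+ {zero}  f g = refl
  sumFin-+ {suc n} f g = trans (cong ((f zero + g zero) +_) (sumFin-+ (f ∘ suc) (g ∘ suc)))
                               (interchange (f zero) (g zero) _ _)
    where
    interchange : ∀ a b c d → (a + b) + (c + d) ≡ (a + c) + (b + d)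
    interchange = solve-∀ ℚ-ring

  sumFin-*ˡ : ∀ {n} k (f : Fin n → ℚ) → sumFin (λ i → k * f i) ≡ k * sumFin f
  sumFin-*ˡ {zero}  k f = sym (ℚP.*-zeroʳ k)
  sumFin-*ˡ {suc n} k f = trans (cong ((k * f zero) +_) (sumFin-*ˡ k (f ∘ suc)))
                                (sym (ℚP.*-distribˡ-+ k (f zero) _))

  sumFin-neg : ∀ {n} (f : Fin n → ℚ) → sumFin (λ i → - f i) ≡ - sumFin f
  sumFin-neg {zero}  f = refl
  sumFin-neg {suc n} f = trans (cong ((- f zero) +_) (sumFin-neg (f ∘ suc)))
                               (sym (ℚP.neg-distrib-+ (f zero) _))

  sumFin≡sum : ∀ {n} (f : Fin n → ℚ) → sumFin f ≡ ℚΣ.sum f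
  sumFin≡sum {zero}  f = refl
  sumFin≡sum {suc n} f = cong (f zero +_) (sumFin≡sum (f ∘ suc))

  sumFin-zero : ∀ {n} (f : Fin n → ℚ) → (∀ i → f i ≡ 0ℚ) → sumFin f ≡ 0ℚ
  sumFin-zero f f≡0 = trans (sumFin≡sum f) (ℚΣ.sum-zero f f≡0)

  sumFin-δ : ∀ {n} (f : Fin n → ℚ) i → sumFin (λ j → if ⌊ i ≟ j ⌋ then f j else 0ℚ) ≡ f i
  sumFin-δ f i = trans (sumFin≡sum δf) (trans (ℚΣ.sum-single δf i off-diagonal) diagonal)
    where
    δf : Fin _ → ℚ
    δf j = if ⌊ i ≟ j ⌋ then f j else 0ℚ
    off-diagonal : ∀ j → j ≢ i → δf j ≡ 0ℚ
    off-diagonal j j≢i rewrite ⌊≟⌋-≢ (j≢i ∘ sym) = refl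
    diagonal : δf i ≡ f i
    diagonal rewrite ⌊≟⌋-refl i = refl

  sumFin-select-suc : ∀ {n} (i : Fin (suc n)) k (z : Fin n → ℚ) →
                      sumFin (λ j → (if ⌊ i ≟ suc j ⌋ then k else 0ℚ) * z j) ≡ k * (0ℚ Vector.∷ z) i
  sumFin-select-suc zero    k z = trans (sumFin-zero _ (ℚP.*-zeroˡ ∘ z)) (sym (ℚP.*-zeroʳ k))
  sumFin-select-suc (suc i) k z = trans (sumFin-cong select) (sumFin-δ (λ j → k * z j) i)
    where
    select : ∀ j → (if ⌊ suc i ≟ suc j ⌋ then k else 0ℚ) * z j
                   ≡ (if ⌊ i ≟ j ⌋ then k * z j else 0ℚ)
    select j rewrite ⌊⌋-map′ (cong suc) suc-injective (i ≟ j) with ⌊ i ≟ j ⌋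
    ... | true  = refl
    ... | false = ℚP.*-zeroˡ (z j)

-- Affine maps and convex hulls

weight : ∀ {A : Set} → List (ℚ × A) → ℚ
weight ws = sumList (map proj₁ ws)

combination : ∀ {k} → List (ℚ × (Fin k → ℚ)) → Fin k → ℚ
combination ws i = sumList (map (λ w → proj₁ w ℚ.* proj₂ w i) ws)

module AffineMap {m n} (A : Fin n → Fin m → ℚ) (c : Fin n → ℚ) where
  open import Data.Rational using (_+_; _*_; _-_; -_; _≤_)
  open import Algebra.Properties.Group ℚP.+-0-group
    using (∙-cancelʳ; x∙y⁻¹≈ε⇒x≈y; x≈y⇒x∙y⁻¹≈ε)
  open ≡-Reasoning

  linear : (Fin m → ℚ) → Fin n → ℚ
  linear x i = sumFin (λ j → A i j * x j)

  affine : (Fin m → ℚ) → Fin n → ℚ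
  affine x i = linear x i + c i

  affine-cong : ∀ {x y} → x ≗ y → affine x ≗ affine y
  affine-cong x≗y i = cong (_+ c i) (sumFin-cong (λ j → cong (A i j *_) (x≗y j)))

  linear-*-+ : ∀ k x y i → linear (λ j → k * x j + y j) i ≡ k * linear x i + linear y i
  linear-*-+ k x y i = begin
    sumFin (λ j → A i j * (k * x j + y j))
      ≡⟨ sumFin-cong (λ j → distrib (A i j) k (x j) (y j)) ⟩
    sumFin (λ j → k * (A i j * x j) + A i j * y j)
      ≡⟨ sumFin-+ (λ j → k * (A i j * x j)) (λ j → A i j * y j) ⟩
    sumFin (λ j → k * (A i j * x j)) + linear y i
      ≡⟨ cong (_+ linear y i) (sumFin-*ˡ k (λ j → A i j * x j)) ⟩
    k * linear x i + linear y i ∎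
    where
    distrib : ∀ a k x y → a * (k * x + y) ≡ k * (a * x) + a * y
    distrib = solve-∀ ℚ-ring

  linear-- : ∀ x y i → linear (λ j → x j - y j) i ≡ linear x i - linear y i
  linear-- x y i = begin
    sumFin (λ j → A i j * (x j - y j))
      ≡⟨ sumFin-cong (λ j → distrib (A i j) (x j) (y j)) ⟩
    sumFin (λ j → A i j * x j + - (A i j * y j))
      ≡⟨ sumFin-+ (λ j → A i j * x j) (λ j → - (A i j * y j)) ⟩
    linear x i + sumFin (λ j → - (A i j * y j))
      ≡⟨ cong (linear x i +_) (sumFin-neg (λ j → A i j * y j)) ⟩
    linear x i - linear y i ∎
    where
    distrib : ∀ a x y → a * (x - y) ≡ a * x + - (a * y)
    distrib = solve-∀ ℚ-ring

  linear-combination : ∀ ws i → linear (combination ws) i + weight ws * c i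
                              ≡ sumList (map (λ w → proj₁ w * affine (proj₂ w) i) ws)
  linear-combination [] i =
    cong₂ _+_ (sumFin-zero _ (ℚP.*-zeroʳ ∘ A i)) (ℚP.*-zeroˡ (c i))
  linear-combination ((a , p) ∷ ws) i = begin
    linear (λ j → a * p j + combination ws j) i + (a + weight ws) * c i
      ≡⟨ cong (_+ (a + weight ws) * c i) (linear-*-+ a p (combination ws) i) ⟩
    (a * linear p i + linear (combination ws) i) + (a + weight ws) * c i
      ≡⟨ regroup a (linear p i) (linear (combination ws) i) (weight ws) (c i) ⟩
    a * affine p i + (linear (combination ws) i + weight ws * c i)
      ≡⟨ cong (a * affine p i +_) (linear-combination ws i) ⟩
    a * affine p i + sumList (map (λ w → proj₁ w * affine (proj₂ w) i) ws) ∎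
    where
    regroup : ∀ a l r w c → (a * l + r) + (a + w) * c ≡ a * (l + c) + (r + w * c)
    regroup = solve-∀ ℚ-ring

  affine-combination : ∀ ws → weight ws ≡ 1ℚ → ∀ i →
                       affine (combination ws) i ≡ sumList (map (λ w → proj₁ w * affine (proj₂ w) i) ws)
  affine-combination ws w≡1 i = begin
    l + c i              ≡⟨ cong (l +_) (ℚP.*-identityˡ (c i)) ⟨
    l + 1ℚ * c i         ≡⟨ cong (λ w → l + w * c i) w≡1 ⟨
    l + weight ws * c i  ≡⟨ linear-combination ws i ⟩
    sumList (map (λ w → proj₁ w * affine (proj₂ w) i) ws) ∎
    where
    l = linear (combination ws) i

  affine-injective : (∀ z → (∀ i → linear z i ≡ 0ℚ) → ∀ j → z j ≡ 0ℚ) →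
                     ∀ {x y} → (∀ i → affine x i ≡ affine y i) → x ≗ y
  affine-injective kernel-trivial {x} {y} ax≡ay j =
    x∙y⁻¹≈ε⇒x≈y (x j) (y j) (kernel-trivial (λ j → x j - y j) linear[x-y]≡0 j)
    where
    linear[x-y]≡0 : ∀ i → linear (λ j → x j - y j) i ≡ 0ℚ
    linear[x-y]≡0 i =
      trans (linear-- x y i) (x≈y⇒x∙y⁻¹≈ε (∙-cancelʳ (c i) (linear x i) (linear y i) (ax≡ay i)))

  ConvHull-image : ∀ {S : (Fin m → ℚ) → Set} {T : (Fin n → ℚ) → Set} →
                   (∀ p → S p → T (affine p)) → ∀ x → ConvHull S x → ConvHull T (affine x)
  ConvHull-image S⇒T x (ws , ws∈S , w≡1 , x≗) =
    map (map₂ affine) ws ,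
    map⁺ (All.map (map₂ (S⇒T _)) ws∈S) ,
    trans (cong sumList (sym (map-∘ ws))) w≡1 ,
    λ i → trans (affine-cong x≗ i) (trans (affine-combination ws w≡1 i) (cong sumList (map-∘ ws)))

  ConvHull-preimage : ∀ {S : (Fin m → ℚ) → Set} {T : (Fin n → ℚ) → Set} →
                      (∀ q → T q → ∃[ p ] (S p × (∀ i → affine p i ≡ q i))) →
                      ∀ z → ConvHull T z → ∃[ x ] (ConvHull S x × (∀ i → affine x i ≡ z i))
  ConvHull-preimage {S} {T} T⇒S z (ws , ws∈T , w≡1 , z≗) =
    let vs , vs∈S , weights≡ , images≡ = lift ws ws∈T
        vw≡1 = trans (cong sumList weights≡) w≡1
    in combination vs , (vs , vs∈S , vw≡1 , λ _ → refl) ,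
       λ i → trans (affine-combination vs vw≡1 i) (trans (images≡ i) (sym (z≗ i)))
    where
    lift : ∀ ws → All (λ w → 0ℚ ≤ proj₁ w × T (proj₂ w)) ws →
           Σ[ vs ∈ List (ℚ × (Fin m → ℚ)) ] All (λ v → 0ℚ ≤ proj₁ v × S (proj₂ v)) vs
             × map proj₁ vs ≡ map proj₁ ws
             × (∀ i → sumList (map (λ v → proj₁ v * affine (proj₂ v) i) vs) ≡ combination ws i)
    lift [] [] = [] , [] , refl , λ _ → refl
    lift ((a , q) ∷ ws) ((0≤a , Tq) ∷ ws∈T) =
      let p , Sp , p↦q = T⇒S q Tq
          vs , vs∈S , weights≡ , images≡ = lift ws ws∈T
      in (a , p) ∷ vs , (0≤a , Sp) ∷ vs∈S , cong (a ∷_) weights≡ ,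
         λ i → cong₂ _+_ (cong (a *_) (p↦q i)) (images≡ i)

module _ (G : PlaneBipartiteGraph) where
  open PlaneBipartiteGraph G
  open ≡-Reasoning

  tail : Dart nE → Vertex G
  tail d = end (proj₁ d) (proj₂ d)

  Adjacent : Vertex G → Vertex G → Set
  Adjacent u w = ∃[ e ] ((end e true ≡ u × end e false ≡ w) ⊎ (end e false ≡ u × end e true ≡ w))

  black-end-false : ∀ e → black (end e false) ≡ not (black (end e true))
  black-end-false e = ¬-not (proper e ∘ sym)

  black-rev : ∀ d → black (tail (rev d)) ≡ not (black (tail d))
  black-rev (e , true)  = black-end-false e
  black-rev (e , false) = ¬-not (proper e)

  rev-involutive : ∀ d → rev {nE} (rev d) ≡ d
  rev-involutive (e , s) = cong (e ,_) (not-involutive s)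

  φ φ⁻¹ : Dart nE → Dart nE
  φ d   = σ (rev d)
  φ⁻¹ d = rev (σ⁻¹ d)

  φ∘φ⁻¹ : ∀ d → φ (φ⁻¹ d) ≡ d
  φ∘φ⁻¹ d = trans (cong σ (rev-involutive (σ⁻¹ d))) (σσ⁻¹ d)

  φ⁻¹∘φ : ∀ d → φ⁻¹ (φ d) ≡ d
  φ⁻¹∘φ d = trans (cong rev (σ⁻¹σ (rev d))) (rev-involutive d)

  black-φ : ∀ d → black (tail (φ d)) ≡ not (black (tail d))
  black-φ d = trans (cong black (σ-tail (rev d))) (black-rev d)

  module _ where
    open import Data.Nat using (_+_; _≤_)

    dartAt : Fin (nE + nE) → Dart nE
    dartAt i = [ (_, true) , (_, false) ]′ (splitAt nE i)

    dartIndex : Dart nE → Fin (nE + nE)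
    dartIndex (e , true)  = e ↑ˡ nE
    dartIndex (e , false) = nE ↑ʳ e

    dartAt-dartIndex : ∀ d → dartAt (dartIndex d) ≡ d
    dartAt-dartIndex (e , true)  rewrite splitAt-↑ˡ nE e nE = refl
    dartAt-dartIndex (e , false) rewrite splitAt-↑ʳ nE nE e = refl

    dartIndex-dartAt : ∀ i → dartIndex (dartAt i) ≡ i
    dartIndex-dartAt i with splitAt nE i in eq
    ... | inj₁ _ = splitAt⁻¹-↑ˡ eq
    ... | inj₂ _ = splitAt⁻¹-↑ʳ eq

    sumDarts : (Dart nE → ℕ) → ℕ
    sumDarts h = sum (λ e → h (e , true)) + sum (λ e → h (e , false))

    sumDarts-cong : ∀ {h h'} → h ≗ h' → sumDarts h ≡ sumDarts h'
    sumDarts-cong h≗h' = cong₂ _+_ (sum-cong-≗ (h≗h' ∘ (_, true))) (sum-cong-≗ (h≗h' ∘ (_, false)))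

    sumDarts≡sum∘dartAt : ∀ h → sumDarts h ≡ sum (h ∘ dartAt)
    sumDarts≡sum∘dartAt h = sym (trans (sum-↑ˡ-↑ʳ nE (h ∘ dartAt))
      (sumDarts-cong {h ∘ dartAt ∘ dartIndex} (cong h ∘ dartAt-dartIndex)))

    sumDarts-bijection : ∀ (f g : Dart nE → Dart nE) → (∀ d → f (g d) ≡ d) → (∀ d → g (f d) ≡ d) →
                         ∀ h → sumDarts (h ∘ f) ≡ sumDarts h
    sumDarts-bijection f g f∘g g∘f h = begin
      sumDarts (h ∘ f)                    ≡⟨ sumDarts≡sum∘dartAt (h ∘ f) ⟩
      sum (h ∘ f ∘ dartAt)                ≡⟨ sum-cong-≗ (λ i → cong h (dartAt-dartIndex (f (dartAt i)))) ⟨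
      sum (h ∘ dartAt ∘ (π ⟨$⟩ʳ_))        ≡⟨ sum-permute (h ∘ dartAt) π ⟨
      sum (h ∘ dartAt)                    ≡⟨ sumDarts≡sum∘dartAt h ⟨
      sumDarts h                          ∎
      where
      inverse : ∀ f g → (∀ d → f (g d) ≡ d) → ∀ i → dartIndex (f (dartAt (dartIndex (g (dartAt i))))) ≡ i
      inverse f g f∘g i = trans (cong (dartIndex ∘ f) (dartAt-dartIndex _))
                                (trans (cong dartIndex (f∘g _)) (dartIndex-dartAt i))
      π = permutation (dartIndex ∘ f ∘ dartAt) (dartIndex ∘ g ∘ dartAt)
                      (inverse f g f∘g) (inverse g f g∘f)

    blackTailOn whiteTailOn : BFace G → Dart nE → Bool
    blackTailOn b d = ⌊ face d ≟ suc b ⌋ ∧ black (tail d)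
    whiteTailOn b d = ⌊ face d ≟ suc b ⌋ ∧ not (black (tail d))

    whiteTailOn-φ : ∀ b d → whiteTailOn b (φ d) ≡ blackTailOn b d
    whiteTailOn-φ b d rewrite face-φ d | black-φ d | not-involutive (black (tail d)) = refl

    face-balance : ∀ b → sum (λ e → 𝟙 (isBW G b e)) ≡ sum (λ e → 𝟙 (isWB G b e))
    face-balance b = begin
      sum (λ e → 𝟙 (isBW G b e))
        ≡⟨ sum-cong-≗ (λ e → 𝟙-∨-opposite (onFace G b e true) (onFace G b e false) _
                                          (black-end-false e)) ⟩
      sum (λ e → 𝟙 (blackTailOn b (e , true)) + 𝟙 (blackTailOn b (e , false)))
        ≡⟨ ∑-distrib-+ (λ e → 𝟙 (blackTailOn b (e , true))) (λ e → 𝟙 (blackTailOn b (e , false))) ⟩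
      sumDarts (𝟙 ∘ blackTailOn b)
        ≡⟨ sumDarts-cong (cong 𝟙 ∘ whiteTailOn-φ b) ⟨
      sumDarts (𝟙 ∘ whiteTailOn b ∘ φ)
        ≡⟨ sumDarts-bijection φ φ⁻¹ φ∘φ⁻¹ φ⁻¹∘φ (𝟙 ∘ whiteTailOn b) ⟩
      sumDarts (𝟙 ∘ whiteTailOn b)
        ≡⟨ ∑-distrib-+ (λ e → 𝟙 (whiteTailOn b (e , true))) (λ e → 𝟙 (whiteTailOn b (e , false))) ⟨
      sum (λ e → 𝟙 (whiteTailOn b (e , true)) + 𝟙 (whiteTailOn b (e , false)))
        ≡⟨ sum-cong-≗ (λ e → 𝟙-∨-opposite (onFace G b e true) (onFace G b e false) _
                                          (cong not (black-end-false e))) ⟨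
      sum (λ e → 𝟙 (isWB G b e)) ∎

    -- Perfect matchings and flips

    blackEnd : Edge G → Vertex G
    blackEnd e = if black (end e true) then end e true else end e false

    blackEnd-black : ∀ e → black (blackEnd e) ≡ true
    blackEnd-black e with black (end e true) in black₁
    ... | true  = black₁
    ... | false = trans (black-end-false e) (cong not black₁)

    blackEnd-incident : ∀ e → Incident G e (blackEnd e)
    blackEnd-incident e with black (end e true)
    ... | true  = inj₁ refl
    ... | false = inj₂ refl

    incident⇒blackEnd : ∀ {e v} → black v ≡ true → Incident G e v → blackEnd e ≡ v
    incident⇒blackEnd {e} v-black (inj₁ refl) with black (end e true)
    ... | true  = refl
    ... | false = contradiction v-black λ ()
    incident⇒blackEnd {e} v-black (inj₂ refl) with black (end e true) in black₁
    ... | true  = contradiction (trans (sym v-black) (trans (black-end-false e) (cong not black₁))) λ ()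
    ... | false = refl

    covers : Matching G → Edge G → Vertex G → ℕ
    covers M e v = 𝟙 (lookup M e ∧ ⌊ blackEnd e ≟ v ⌋)

    covers-row : ∀ M e → sum (covers M e) ≡ 𝟙 (lookup M e)
    covers-row M e = trans (sum-single (covers M e) (blackEnd e) elsewhere) at-blackEnd
      where
      elsewhere : ∀ v → v ≢ blackEnd e → covers M e v ≡ 0
      elsewhere v v≢ rewrite ⌊≟⌋-≢ (v≢ ∘ sym) | ∧-zeroʳ (lookup M e) = refl
      at-blackEnd : covers M e (blackEnd e) ≡ 𝟙 (lookup M e)
      at-blackEnd rewrite ⌊≟⌋-refl (blackEnd e) | ∧-identityʳ (lookup M e) = refl

    covers-column : ∀ {M} → IsPerfectMatching G M → ∀ v → sum (λ e → covers M e v) ≡ 𝟙 (black v)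
    covers-column {M} M-perfect v with black v in v-colour | proj₁ (M-perfect v)
    ... | false | _ = sum-zero _ uncovered
      where
      uncovered : ∀ e → covers M e v ≡ 0
      uncovered e with blackEnd e ≟ v
      ... | yes refl = contradiction (trans (sym (blackEnd-black e)) v-colour) λ ()
      ... | no _     = cong 𝟙 (∧-zeroʳ (lookup M e))
    ... | true | e₀ , e₀∈M , e₀∼v = trans (sum-single (λ e → covers M e v) e₀ others) covered
      where
      covered : covers M e₀ v ≡ 1
      covered rewrite e₀∈M | incident⇒blackEnd v-colour e₀∼v | ⌊≟⌋-refl v = refl
      others : ∀ e → e ≢ e₀ → covers M e v ≡ 0
      others e e≢e₀ with lookup M e in e∈M | blackEnd e ≟ v
      ... | false | _    = refl
      ... | true  | no _ = refl
      ... | true  | yes blackEnd≡v = contradiction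
        (proj₂ (M-perfect v) e e₀ e∈M e₀∈M (subst (Incident G e) blackEnd≡v (blackEnd-incident e)) e₀∼v)
        e≢e₀

    perfectMatching-size : ∀ {M} → IsPerfectMatching G M →
                           sum (λ e → 𝟙 (lookup M e)) ≡ sum (λ v → 𝟙 (black v))
    perfectMatching-size {M} M-perfect = begin
      sum (λ e → 𝟙 (lookup M e))            ≡⟨ sum-cong-≗ (covers-row M) ⟨
      sum (λ e → sum (λ v → covers M e v))  ≡⟨ ∑-comm (covers M) ⟩
      sum (λ v → sum (λ e → covers M e v))  ≡⟨ sum-cong-≗ (covers-column {M} M-perfect) ⟩
      sum (λ v → 𝟙 (black v))               ∎

    flipCount : (BFace G → Edge G → Bool) → List (BFace G) → Edge G → ℕ
    flipCount P []       e = 0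
    flipCount P (b ∷ fs) e = 𝟙 (P b e) + flipCount P fs e

    flipCount-balance : ∀ fs → sum (flipCount (isBW G) fs) ≡ sum (flipCount (isWB G) fs)
    flipCount-balance []       = refl
    flipCount-balance (b ∷ fs) = begin
      sum (flipCount (isBW G) (b ∷ fs))
        ≡⟨ ∑-distrib-+ (λ e → 𝟙 (isBW G b e)) (flipCount (isBW G) fs) ⟩
      sum (λ e → 𝟙 (isBW G b e)) + sum (flipCount (isBW G) fs)
        ≡⟨ cong₂ _+_ (face-balance b) (flipCount-balance fs) ⟩
      sum (λ e → 𝟙 (isWB G b e)) + sum (flipCount (isWB G) fs)
        ≡⟨ ∑-distrib-+ (λ e → 𝟙 (isWB G b e)) (flipCount (isWB G) fs) ⟨
      sum (flipCount (isWB G) (b ∷ fs)) ∎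

    -- A flip need not start from a perfect matching, so some white-black edges of the
    -- face may already be present; the slack r counts those actually added.
    downFlip-slack : ∀ {b M₁ M₀} → DownFlip G b M₁ M₀ → ∀ e →
                     ∃[ r ] (r ≤ 𝟙 (isWB G b e) × 𝟙 (lookup M₁ e) + r ≡ 𝟙 (lookup M₀ e) + 𝟙 (isBW G b e))
    downFlip-slack {b} {M₁} (BW⊆M₁ , M₀-flip) e rewrite M₀-flip e with isBW G b e in e-BW
    ... | true rewrite BW⊆M₁ e e-BW = 0 , z≤n , refl
    ... | false with isWB G b e
    ...   | false = 0 , z≤n , refl
    ...   | true with lookup M₁ e
    ...     | true  = 0 , z≤n , refl
    ...     | false = 1 , ℕP.≤-refl , refl

    upChain-slack : ∀ {M₀ M fs} → UpChain G M₀ M fs → ∀ e →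
                    ∃[ r ] (r ≤ flipCount (isWB G) fs e
                          × 𝟙 (lookup M e) + r ≡ 𝟙 (lookup M₀ e) + flipCount (isBW G) fs e)
    upChain-slack done e = 0 , z≤n , refl
    upChain-slack {M₀} {M} (step {M₁ = M₁} {b = b} {fs = fs} flip rest) e =
      let r₁ , r₁≤ , flip≡ = downFlip-slack {b} {M₁} {M₀} flip e
          r  , r≤  , rest≡ = upChain-slack rest e
      in r₁ + r , ℕP.+-mono-≤ r₁≤ r≤ , (begin
        𝟙 (lookup M e) + (r₁ + r)                     ≡⟨ swap (𝟙 (lookup M e)) r₁ r ⟩
        r₁ + (𝟙 (lookup M e) + r)                     ≡⟨ cong (r₁ +_) rest≡ ⟩
        r₁ + (𝟙 (lookup M₁ e) + flipCount (isBW G) fs e) ≡⟨ regroup r₁ (𝟙 (lookup M₁ e)) _ ⟩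
        (𝟙 (lookup M₁ e) + r₁) + flipCount (isBW G) fs e ≡⟨ cong (_+ flipCount (isBW G) fs e) flip≡ ⟩
        (𝟙 (lookup M₀ e) + 𝟙 (isBW G b e)) + flipCount (isBW G) fs e
          ≡⟨ ℕP.+-assoc (𝟙 (lookup M₀ e)) (𝟙 (isBW G b e)) (flipCount (isBW G) fs e) ⟩
        𝟙 (lookup M₀ e) + flipCount (isBW G) (b ∷ fs) e ∎)
      where
      swap : ∀ m r₁ r → m + (r₁ + r) ≡ r₁ + (m + r)
      swap = ℕ-solve-∀
      regroup : ∀ r₁ m B → r₁ + (m + B) ≡ (m + r₁) + B
      regroup = ℕ-solve-∀

    upChain-balance : ∀ {M₀ M fs} → IsPerfectMatching G M₀ → IsPerfectMatching G M →
                      UpChain G M₀ M fs → ∀ e →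
                      𝟙 (lookup M e) + flipCount (isWB G) fs e ≡ 𝟙 (lookup M₀ e) + flipCount (isBW G) fs e
    upChain-balance {M₀} {M} {fs} M₀-perfect M-perfect chain e =
      trans (cong (m e +_) (sym (r≗wb e))) (balance e)
      where
      m m₀ bw wb r : Edge G → ℕ
      m e  = 𝟙 (lookup M e)
      m₀ e = 𝟙 (lookup M₀ e)
      bw   = flipCount (isBW G) fs
      wb   = flipCount (isWB G) fs
      r e  = proj₁ (upChain-slack chain e)
      r≤wb : ∀ e → r e ≤ wb e
      r≤wb e = proj₁ (proj₂ (upChain-slack chain e))
      balance : ∀ e → m e + r e ≡ m₀ e + bw e
      balance e = proj₂ (proj₂ (upChain-slack chain e))
      same-size : sum m₀ ≡ sum m
      same-size = trans (perfectMatching-size {M₀} M₀-perfect) (sym (perfectMatching-size {M} M-perfect))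
      totals : sum m + sum r ≡ sum m + sum wb
      totals = begin
        sum m + sum r            ≡⟨ ∑-distrib-+ m r ⟨
        sum (λ e → m e + r e)    ≡⟨ sum-cong-≗ balance ⟩
        sum (λ e → m₀ e + bw e)  ≡⟨ ∑-distrib-+ m₀ bw ⟩
        sum m₀ + sum bw          ≡⟨ cong₂ _+_ same-size (flipCount-balance fs) ⟩
        sum m + sum wb           ∎
      r≗wb : r ≗ wb
      r≗wb = ≤∧sum≡⇒≗ r≤wb (ℕP.+-cancelˡ-≡ (sum m) (sum r) (sum wb) totals)

  -- The matrix A_G

  module _ where
    open import Data.Rational using (_+_; _*_; _-_)

    χ≡ℕ→ℚ𝟙 : ∀ M e → χ G M e ≡ ℕ→ℚ (𝟙 (lookup M e))
    χ≡ℕ→ℚ𝟙 M e with lookup M e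
    ... | true  = refl
    ... | false = refl

    vFace≡BW-WB : ∀ b e → vFace G b e ≡ ℕ→ℚ (𝟙 (isBW G b e)) - ℕ→ℚ (𝟙 (isWB G b e))
    vFace≡BW-WB b e =
      sign-∨-opposite (onFace G b e true) (onFace G b e false) (black (end e true)) (black-end-false e)

    vFace-countFace : ∀ fs e → sumFin (λ b → vFace G b e * ℕ→ℚ (countFace G fs b))
                               ≡ ℕ→ℚ (flipCount (isBW G) fs e) - ℕ→ℚ (flipCount (isWB G) fs e)
    vFace-countFace []       e = sumFin-zero _ (λ b → ℚP.*-zeroʳ (vFace G b e))
    vFace-countFace (b ∷ fs) e = begin
      sumFin (λ c → v c * ℕ→ℚ (𝟙 ⌊ b ≟ c ⌋ ℕ.+ countFace G fs c))
        ≡⟨ sumFin-cong (λ c → trans (cong (v c *_) (ℕ→ℚ-homo-+ (𝟙 ⌊ b ≟ c ⌋) (countFace G fs c)))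
                                   (ℚP.*-distribˡ-+ (v c) (ℕ→ℚ (𝟙 ⌊ b ≟ c ⌋)) (ℕ→ℚ (countFace G fs c)))) ⟩
      sumFin (λ c → v c * ℕ→ℚ (𝟙 ⌊ b ≟ c ⌋) + v c * ℕ→ℚ (countFace G fs c))
        ≡⟨ sumFin-+ (λ c → v c * ℕ→ℚ (𝟙 ⌊ b ≟ c ⌋)) (λ c → v c * ℕ→ℚ (countFace G fs c)) ⟩
      sumFin (λ c → v c * ℕ→ℚ (𝟙 ⌊ b ≟ c ⌋)) + sumFin (λ c → v c * ℕ→ℚ (countFace G fs c))
        ≡⟨ cong₂ _+_ (trans (sumFin-cong (λ c → *-ℕ→ℚ𝟙 (v c) ⌊ b ≟ c ⌋)) (sumFin-δ v b))
                     (vFace-countFace fs e) ⟩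
      v b + (ℕ→ℚ B - ℕ→ℚ W)
        ≡⟨ cong (_+ (ℕ→ℚ B - ℕ→ℚ W)) (vFace≡BW-WB b e) ⟩
      (ℕ→ℚ bw - ℕ→ℚ wb) + (ℕ→ℚ B - ℕ→ℚ W)
        ≡⟨ regroup (ℕ→ℚ bw) (ℕ→ℚ wb) (ℕ→ℚ B) (ℕ→ℚ W) ⟩
      (ℕ→ℚ bw + ℕ→ℚ B) - (ℕ→ℚ wb + ℕ→ℚ W)
        ≡⟨ cong₂ _-_ (ℕ→ℚ-homo-+ bw B) (ℕ→ℚ-homo-+ wb W) ⟨
      ℕ→ℚ (bw ℕ.+ B) - ℕ→ℚ (wb ℕ.+ W) ∎
      where
      v : BFace G → ℚ
      v c = vFace G c e
      bw = 𝟙 (isBW G b e)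
      wb = 𝟙 (isWB G b e)
      B = flipCount (isBW G) fs e
      W = flipCount (isWB G) fs e
      regroup : ∀ bw wb B W → (bw - wb) + (B - W) ≡ (bw + B) - (wb + W)
      regroup = solve-∀ ℚ-ring

    ψ-countFace : ∀ {M₀ M fs} → IsPerfectMatching G M₀ → IsPerfectMatching G M → UpChain G M₀ M fs →
                  ∀ e → ψ G M₀ (λ b → ℕ→ℚ (countFace G fs b)) e ≡ χ G M e
    ψ-countFace {M₀} {M} {fs} M₀-perfect M-perfect chain e = begin
      sumFin (λ b → vFace G b e * ℕ→ℚ (countFace G fs b)) + χ G M₀ e
        ≡⟨ cong₂ _+_ (vFace-countFace fs e) (χ≡ℕ→ℚ𝟙 M₀ e) ⟩
      (ℕ→ℚ B - ℕ→ℚ W) + ℕ→ℚ m₀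
        ≡⟨ cancel (ℕ→ℚ B) (ℕ→ℚ W) (ℕ→ℚ m₀) (ℕ→ℚ m) balance ⟩
      ℕ→ℚ m
        ≡⟨ χ≡ℕ→ℚ𝟙 M e ⟨
      χ G M e ∎
      where
      m = 𝟙 (lookup M e)
      m₀ = 𝟙 (lookup M₀ e)
      B = flipCount (isBW G) fs e
      W = flipCount (isWB G) fs e
      balance : ℕ→ℚ m + ℕ→ℚ W ≡ ℕ→ℚ m₀ + ℕ→ℚ B
      balance = begin
        ℕ→ℚ m + ℕ→ℚ W     ≡⟨ ℕ→ℚ-homo-+ m W ⟨
        ℕ→ℚ (m ℕ.+ W)     ≡⟨ cong ℕ→ℚ (upChain-balance M₀-perfect M-perfect chain e) ⟩
        ℕ→ℚ (m₀ ℕ.+ B)    ≡⟨ ℕ→ℚ-homo-+ m₀ B ⟩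
        ℕ→ℚ m₀ + ℕ→ℚ B    ∎
      cancel : ∀ B W m₀ m → m + W ≡ m₀ + B → (B - W) + m₀ ≡ m
      cancel B W m₀ m m+W≡m₀+B = begin
        (B - W) + m₀   ≡⟨ regroup B W m₀ ⟩
        (m₀ + B) - W   ≡⟨ cong (_- W) m+W≡m₀+B ⟨
        (m + W) - W    ≡⟨ +-∸ m W ⟩
        m              ∎
        where
        regroup : ∀ B W m₀ → (B - W) + m₀ ≡ (m₀ + B) - W
        regroup = solve-∀ ℚ-ring
        +-∸ : ∀ m W → (m + W) - W ≡ m
        +-∸ = solve-∀ ℚ-ring

    vFace-column : ∀ (z : BFace G → ℚ) e →
                   sumFin (λ b → vFace G b e * z b)
                     ≡ sign (black (end e true))  * (0ℚ Vector.∷ z) (face (e , true))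
                     + sign (black (end e false)) * (0ℚ Vector.∷ z) (face (e , false))
    vFace-column z e = begin
      sumFin (λ b → vFace G b e * z b)
        ≡⟨ sumFin-cong (λ b → ℚP.*-distribʳ-+ (z b) (through true b) (through false b)) ⟩
      sumFin (λ b → through true b * z b + through false b * z b)
        ≡⟨ sumFin-+ (λ b → through true b * z b) (λ b → through false b * z b) ⟩
      sumFin (λ b → through true b * z b) + sumFin (λ b → through false b * z b)
        ≡⟨ cong₂ _+_ (sumFin-select-suc (face (e , true)) _ z) (sumFin-select-suc (face (e , false)) _ z) ⟩
      sign (black (end e true))  * (0ℚ Vector.∷ z) (face (e , true))
        + sign (black (end e false)) * (0ℚ Vector.∷ z) (face (e , false)) ∎
      where
      through : Bool → BFace G → ℚ
      through s b = if onFace G b e s then sign (black (end e s)) else 0ℚ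

    module _ (z : BFace G → ℚ) (Az≡0 : ∀ e → sumFin (λ b → vFace G b e * z b) ≡ 0ℚ) where
      height : Dart nE → ℚ
      height d = (0ℚ Vector.∷ z) (face d)

      height-across : ∀ e → height (e , true) ≡ height (e , false)
      height-across e = sign-opposite-cancel (black (end e true)) (black-end-false e)
                                          (trans (sym (vFace-column z e)) (Az≡0 e))

      height-rev : ∀ d → height (rev d) ≡ height d
      height-rev (e , true)  = sym (height-across e)
      height-rev (e , false) = height-across e

      height-σ : ∀ d → height (σ d) ≡ height d
      height-σ d = begin
        height (σ d)             ≡⟨ cong (height ∘ σ) (rev-involutive d) ⟨
        height (φ (rev d))       ≡⟨ cong (0ℚ Vector.∷ z) (face-φ (rev d)) ⟩
        height (rev d)           ≡⟨ height-rev d ⟩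
        height d                 ∎

      height-iter-σ : ∀ k d → height (iter σ k d) ≡ height d
      height-iter-σ zero    d = refl
      height-iter-σ (suc k) d = trans (height-σ (iter σ k d)) (height-iter-σ k d)

      Flat : Vertex G → Set
      Flat v = ∀ d → tail d ≡ v → height d ≡ 0ℚ

      flat-at-tail : ∀ d → height d ≡ 0ℚ → Flat (tail d)
      flat-at-tail d height≡0 d' tail≡ =
        let k , σᵏd≡d' = σ-cyc d d' (sym tail≡)
        in trans (cong height (sym σᵏd≡d')) (trans (height-iter-σ k d) height≡0)

      flat-across-edge : ∀ {u w} → Adjacent u w → Flat u → Flat w
      flat-across-edge (e , inj₁ (refl , refl)) flat =
        flat-at-tail (e , false) (trans (height-rev (e , true)) (flat (e , true) refl))
      flat-across-edge (e , inj₂ (refl , refl)) flat =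
        flat-at-tail (e , true) (trans (height-rev (e , false)) (flat (e , false) refl))

      vFace-kernel-trivial : ∀ b → z b ≡ 0ℚ
      vFace-kernel-trivial b =
        let d₀ , d₀-outer = face-surj zero
            d  , d-on-b   = face-surj (suc b)
            transport = fold (λ u w → Flat u → Flat w) (λ edge rest → rest ∘ flat-across-edge edge) id
            flat-at-d = transport (connected (tail d₀) (tail d))
                                  (flat-at-tail d₀ (cong (0ℚ Vector.∷ z) d₀-outer))
        in trans (cong (0ℚ Vector.∷ z) (sym d-on-b)) (flat-at-d d refl)

  ≼⇒UpChain : ∀ {M₀ M} → _≼_ G M₀ M → ∃[ fs ] UpChain G M₀ M fs
  ≼⇒UpChain = foldl (λ M X → ∃[ fs ] UpChain G X M fs)
                    (λ (fs , chain) (b , flip) → b ∷ fs , step flip chain)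
                    ([] , done)

  exponent⇒perfectMatching : ∀ {M₀ x} → IsPerfectMatching G M₀ → DExponent G M₀ x →
                             ∃[ M ] (IsPerfectMatching G M × (∀ e → ψ G M₀ x e ≡ χ G M e))
  exponent⇒perfectMatching {M₀} M₀-perfect (M , fs , M-perfect , chain , x≡count) =
    M , M-perfect , λ e → trans (affine-cong x≡count e) (ψ-countFace M₀-perfect M-perfect chain e)
    where open AffineMap (λ e b → vFace G b e) (χ G M₀)

  perfectMatching⇒exponent : ∀ {M₀} → IsBottom G M₀ → ∀ (q : Edge G → ℚ) →
                             ∃[ M ] (IsPerfectMatching G M × (∀ e → q e ≡ χ G M e)) →
                             Σ[ x ∈ (BFace G → ℚ) ] (DExponent G M₀ x × (∀ e → ψ G M₀ x e ≡ q e))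
  perfectMatching⇒exponent (M₀-perfect , M₀-bottom) q (M , M-perfect , q≡χ) =
    let fs , chain = ≼⇒UpChain (M₀-bottom M M-perfect)
    in (λ b → ℕ→ℚ (countFace G fs b)) , (M , fs , M-perfect , chain , λ _ → refl) ,
       λ e → trans (ψ-countFace M₀-perfect M-perfect chain e) (sym (q≡χ e))

theorem3p6 : (G : PlaneBipartiteGraph) → EveryEdgeInPM G →
    (M₀ : Matching G) → IsBottom G M₀ →
      (∀ x → Newton-D G M₀ x → PMPolytope G (ψ G M₀ x))
    × (∀ x y → Newton-D G M₀ x → Newton-D G M₀ y →
         (∀ e → ψ G M₀ x e ≡ ψ G M₀ y e) → ∀ f → x f ≡ y f)
    × (∀ z → PMPolytope G z →
         ∃[ x ] (Newton-D G M₀ x × (∀ e → ψ G M₀ x e ≡ z e)))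
theorem3p6 G _ M₀ M₀-bottom =
    ConvHull-image (λ _ → exponent⇒perfectMatching G (proj₁ M₀-bottom))
  , (λ _ _ _ _ → affine-injective (vFace-kernel-trivial G))
  , ConvHull-preimage (perfectMatching⇒exponent G M₀-bottom)
  where open AffineMap (λ e b → vFace G b e) (χ G M₀)
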